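{- Let $G$ be a graph of treelength at most $k\geq 1$. If $A\subseteq V(G)$ is such that $G[A]$ is connected, then every shortest path in $G$ between two vertices $a,b \in A$ is contained in $N^{\leq 3k/2}[A]$.
   Context: Graphs are simple and undirected. $N^{\leq i}[A]=\{v\in V(G): d_G(v,a)\le i \text{ for some } a\in A\}$. A tree decomposition of $G$ is a pair $(T,(B_t)_{t\in V(T)})$ with $T$ a tree and $B_t\subseteq V(G)$, such that for every $v$ the set $\{t: v\in B_t\}$ is nonempty and induces a subtree of $T$, and every edge of $G$ lies in some bag. The treelength of $G$ is the minimum $k$ such that $G$ has a tree decomposition in which any two vertices sharing a bag are at distance at most $k$ in $G$. -}

module Defs where

open import Data.Nat using (ℕ; zero; suc; _≤_; _*_)
open import Data.Fin using (Fin)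
open import Data.List using (List; []; _∷_; _++_; length)
open import Data.List.Relation.Unary.Linked using (Linked)
open import Data.List.Relation.Unary.Unique.Propositional using (Unique)
open import Data.Product using (Σ; ∃; ∃-syntax; _×_; _,_)
open import Relation.Nullary using (¬_)

record Graph (n : ℕ) : Set₁ where
  field
    Adj    : Fin n → Fin n → Set
    sym    : ∀ {u v} → Adj u v → Adj v u
    irrefl : ∀ v → ¬ Adj v v
open Graph public

module _ {n : ℕ} (G : Graph n) where

  data Walk : Fin n → Fin n → ℕ → Set where
    []   : ∀ {u} → Walk u u zero
    step : ∀ {u v w ℓ} → Adj G u v → Walk v w ℓ → Walk u w (suc ℓ)

  data AllOn (P : Fin n → Set) : ∀ {u w ℓ} → Walk u w ℓ → Set where
    []   : ∀ {u} → P u → AllOn P ([] {u})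
    step : ∀ {u v w ℓ} {e : Adj G u v} {p : Walk v w ℓ} →
           P u → AllOn P p → AllOn P (step e p)

  DistLe : Fin n → Fin n → ℕ → Set
  DistLe u v i = ∃[ ℓ ] (ℓ ≤ i × Walk u v ℓ)

  InducedConnected : (Fin n → Set) → Set
  InducedConnected A = ∀ u v → A u → A v →
    ∃[ ℓ ] Σ (Walk u v ℓ) (AllOn A)

  Connected : Set
  Connected = ∀ u v → ∃[ ℓ ] Walk u v ℓ

  HasCycle : Set
  HasCycle = ∃[ x ] ∃[ xs ] (2 ≤ length xs × Unique (x ∷ xs)
             × Linked (Adj G) (x ∷ xs ++ (x ∷ [])))

  IsTree : Set
  IsTree = Connected × ¬ HasCycle

  -- The shortest paths: a walk P from a to b of length ℓ such that no
  -- walk from a to b is shorter (such a walk is necessarily a path).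
  IsShortest : ∀ {a b ℓ} → Walk a b ℓ → Set
  IsShortest {a} {b} {ℓ} _ = ∀ ℓ' → Walk a b ℓ' → ℓ ≤ ℓ'

  InBall : (Fin n → Set) → ℕ → Fin n → Set
  InBall A i v = ∃[ a ] (A a × DistLe v a i)

record TreeDecomposition {n : ℕ} (G : Graph n) : Set₁ where
  field
    m       : ℕ
    T       : Graph m
    isTree  : IsTree T
    Bag     : Fin m → Fin n → Set
    covers  : ∀ v → ∃[ t ] Bag t v
    subtree : ∀ v → InducedConnected T (λ t → Bag t v)
    edges   : ∀ u v → Adj G u v → ∃[ t ] (Bag t u × Bag t v)
open TreeDecomposition public

LengthLe : ∀ {n} {G : Graph n} → TreeDecomposition G → ℕ → Set
LengthLe {G = G} D k =
  ∀ t u v → Bag D t u → Bag D t v → DistLe G u v k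

TreelengthLe : ∀ {n} → Graph n → ℕ → Set₁
TreelengthLe G k = Σ (TreeDecomposition G) (λ D → LengthLe D k)

-- v ∈ N^{≤ 3k/2}[A]: some a ∈ A with d_G(v,a) ≤ 3k/2, i.e. 2·d_G(v,a) ≤ 3k
-- (distances are integers, so no rounding convention is needed).
InBall3k/2 : ∀ {n} → Graph n → (Fin n → Set) → ℕ → Fin n → Set
InBall3k/2 G A k v = ∃[ a ] (A a × ∃[ ℓ ] (2 * ℓ ≤ 3 * k × Walk G v a ℓ))

-- Fix a vertex v of a shortest a–b path P. The walks a → v and v → b along
-- P, together with an a–b walk inside G[A], are carried through the bags
-- into three walks of the decomposition tree forming a triangle, and in a
-- tree such a triangle has a common vertex t. Hence B_t contains a vertex x
-- of P before v, a vertex y of P after v and a vertex a' ∈ A, pairwise at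
-- distance ≤ k. As P is shortest and d(x,y) ≤ k, d(x,v) + d(v,y) ≤ k, so
-- one of x, y lies within k/2 of v, and v lies within 3k/2 of a'.
module Submission where

open import Defs
open import Data.Nat using (ℕ; suc; _≤_; _*_; _+_; z≤n; s≤s; _≤?_)
open import Data.Nat.Properties
  using (≤-refl; ≤-trans; +-comm; +-mono-≤; +-monoʳ-≤; *-monoʳ-≤; +-cancelˡ-≤; +-cancelʳ-≤; ≰⇒≥; module ≤-Reasoning)
open import Data.Nat.Tactic.RingSolver using (solve-∀)
open import Data.Fin using (Fin) renaming (_≟_ to _≟ᶠ_)
open import Data.List using (List; []; _∷_; _++_; [_]; length)
open import Data.List.Relation.Unary.All as All using (All; []; _∷_)
import Data.List.Relation.Unary.All.Properties as All
open import Data.List.Relation.Unary.Any using (here; there)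
open import Data.List.Relation.Unary.Linked using (Linked; [-]; _∷_)
open import Data.List.Relation.Unary.AllPairs using ([]; _∷_)
open import Data.List.Relation.Unary.Unique.Propositional using (Unique)
import Data.List.Relation.Unary.Unique.Propositional.Properties as Unique
open import Data.List.Relation.Binary.Disjoint.Propositional using (Disjoint)
open import Data.List.Relation.Binary.Subset.Propositional using (_⊆_)
open import Data.List.Membership.Propositional using (_∈_; _∉_)
open import Data.List.Membership.Propositional.Properties using (∈-++⁺ˡ; ∈-++⁻)
import Data.List.Membership.DecPropositional as DecMembership
open import Data.Product using (Σ; ∃₂; ∃-syntax; _×_; _,_; proj₂)
open import Data.Sum using (inj₁; inj₂)
open import Data.Empty using (⊥-elim)
open import Function using (_∘_; id)
open import Relation.Nullary using (¬_; yes; no)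
open import Relation.Unary using (Decidable)
open import Relation.Binary.PropositionalEquality
  using (_≡_; refl; cong; subst) renaming (sym to ≡-sym)

module _ {X : Set} where

  Unique-++⁻ˡ : ∀ xs {ys : List X} → Unique (xs ++ ys) → Unique xs
  Unique-++⁻ˡ []       _          = []
  Unique-++⁻ˡ (_ ∷ xs) (x∉ ∷ uniq) = All.++⁻ˡ xs x∉ ∷ Unique-++⁻ˡ xs uniq

  Unique-++⁻ʳ : ∀ xs {ys : List X} → Unique (xs ++ ys) → Unique ys
  Unique-++⁻ʳ []       uniq       = uniq
  Unique-++⁻ʳ (_ ∷ xs) (_ ∷ uniq) = Unique-++⁻ʳ xs uniq

  Unique-++⇒Disjoint : ∀ xs {ys : List X} → Unique (xs ++ ys) → Disjoint xs ys
  Unique-++⇒Disjoint (_ ∷ xs) (x∉ ∷ _) (here refl , v∈ys) = All.lookup (All.++⁻ʳ xs x∉) v∈ys refl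
  Unique-++⇒Disjoint (_ ∷ xs) (_ ∷ uniq) (there v∈xs , v∈ys) = Unique-++⇒Disjoint xs uniq (v∈xs , v∈ys)

module Routes {m : ℕ} (H : Graph m) where
  open DecMembership (_≟ᶠ_ {m}) using (_∈?_)

  data Route : Fin m → Fin m → Set where
    []   : ∀ {u} → Route u u
    step : ∀ {u v w} → Adj H u v → Route v w → Route u w

  variable
    s t u v w x : Fin m

  vertices : Route u w → List (Fin m)
  vertices {u} []         = [ u ]
  vertices {u} (step _ p) = u ∷ vertices p

  departures : Route u w → List (Fin m)
  departures     []         = []
  departures {u} (step _ p) = u ∷ departures p

  IsPath : Route u w → Set
  IsPath p = Unique (vertices p)

  _++ᵣ_ : Route u v → Route v w → Route u w
  []       ++ᵣ q = q
  step e p ++ᵣ q = step e (p ++ᵣ q)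

  reverse : Route u w → Route w u
  reverse []         = []
  reverse (step e p) = reverse p ++ᵣ step (sym H e) []

  vertices≡departures∷ʳ : (p : Route u w) → vertices p ≡ departures p ++ [ w ]
  vertices≡departures∷ʳ     []         = refl
  vertices≡departures∷ʳ {u} (step _ p) = cong (u ∷_) (vertices≡departures∷ʳ p)

  vertices-++ᵣ : (p : Route u v) (q : Route v w) → vertices (p ++ᵣ q) ≡ departures p ++ vertices q
  vertices-++ᵣ     []         q = refl
  vertices-++ᵣ {u} (step _ p) q = cong (u ∷_) (vertices-++ᵣ p q)

  departures-++ᵣ : (p : Route u v) (q : Route v w) → departures (p ++ᵣ q) ≡ departures p ++ departures q
  departures-++ᵣ     []         q = refl
  departures-++ᵣ {u} (step _ p) q = cong (u ∷_) (departures-++ᵣ p q)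

  start∈ : (p : Route u w) → u ∈ vertices p
  start∈ []         = here refl
  start∈ (step _ _) = here refl

  end∈ : (p : Route u w) → w ∈ vertices p
  end∈ []         = here refl
  end∈ (step _ p) = there (end∈ p)

  departures⊆vertices : (p : Route u w) → departures p ⊆ vertices p
  departures⊆vertices p x∈ = subst (_ ∈_) (≡-sym (vertices≡departures∷ʳ p)) (∈-++⁺ˡ x∈)

  vertices-++ᵣ⁺ˡ : (p : Route u v) (q : Route v w) → vertices p ⊆ vertices (p ++ᵣ q)
  vertices-++ᵣ⁺ˡ []         q (here refl) = start∈ q
  vertices-++ᵣ⁺ˡ (step _ p) q (here refl) = here refl
  vertices-++ᵣ⁺ˡ (step _ p) q (there x∈) = there (vertices-++ᵣ⁺ˡ p q x∈)

  vertices-++ᵣ⁺ʳ : (p : Route u v) (q : Route v w) → vertices q ⊆ vertices (p ++ᵣ q)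
  vertices-++ᵣ⁺ʳ []         q x∈ = x∈
  vertices-++ᵣ⁺ʳ (step _ p) q x∈ = there (vertices-++ᵣ⁺ʳ p q x∈)

  vertices-reverse : (p : Route u w) → vertices (reverse p) ⊆ vertices p
  vertices-reverse []         x∈ = x∈
  vertices-reverse (step e p) x∈
    with ∈-++⁻ (departures (reverse p)) (subst (_ ∈_) (vertices-++ᵣ (reverse p) _) x∈)
  ... | inj₁ x∈p                = there (vertices-reverse p (departures⊆vertices (reverse p) x∈p))
  ... | inj₂ (here refl)         = there (start∈ p)
  ... | inj₂ (there (here refl)) = here refl

  All-vertices-++ᵣ : ∀ {P : Fin m → Set} (p : Route u v) (q : Route v w) →
                     All P (vertices p) → All P (vertices q) → All P (vertices (p ++ᵣ q))
  All-vertices-++ᵣ []         q _         Pq = Pq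
  All-vertices-++ᵣ (step _ p) q (Pu ∷ Pp) Pq = Pu ∷ All-vertices-++ᵣ p q Pp Pq

  vertices-linked : (p : Route u w) → Linked (Adj H) (vertices p)
  vertices-linked []                  = [-]
  vertices-linked (step e [])         = e ∷ [-]
  vertices-linked (step e (step f p)) = e ∷ vertices-linked (step f p)

  IsPath⇒Unique-departures : (p : Route u w) → IsPath p → Unique (departures p)
  IsPath⇒Unique-departures p p-path =
    Unique-++⁻ˡ (departures p) (subst Unique (vertices≡departures∷ʳ p) p-path)

  IsPath-++ᵣ⁻ˡ : (p : Route u v) (q : Route v w) → IsPath (p ++ᵣ q) → Unique (departures p)
  IsPath-++ᵣ⁻ˡ p q pq-path = Unique-++⁻ˡ (departures p) (subst Unique (vertices-++ᵣ p q) pq-path)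

  IsPath-++ᵣ⁻ʳ : (p : Route u v) (q : Route v w) → IsPath (p ++ᵣ q) → IsPath q
  IsPath-++ᵣ⁻ʳ p q pq-path = Unique-++⁻ʳ (departures p) (subst Unique (vertices-++ᵣ p q) pq-path)

  IsPath-++ᵣ⁺ : (p : Route u v) (q : Route v w) → Unique (departures p) → IsPath q →
                Disjoint (departures p) (vertices q) → IsPath (p ++ᵣ q)
  IsPath-++ᵣ⁺ p q p-uniq q-path disjoint =
    subst Unique (≡-sym (vertices-++ᵣ p q)) (Unique.++⁺ p-uniq q-path disjoint)

  splitAt : (p : Route u w) → x ∈ vertices p → ∃₂ λ (q : Route u x) (r : Route x w) → p ≡ q ++ᵣ r
  splitAt []         (here refl) = [] , [] , refl
  splitAt (step e p) (here refl) = [] , step e p , refl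
  splitAt (step e p) (there x∈)  with splitAt p x∈
  ... | q , r , refl = step e q , r , refl

  module _ {P : Fin m → Set} (P? : Decidable P) where

    firstHit : (p : Route u w) → P w →
               ∃[ y ] P y × ∃₂ λ (q : Route u y) (r : Route y w) →
                 All (¬_ ∘ P) (departures q) × p ≡ q ++ᵣ r
    firstHit {u} p Pw with P? u
    ... | yes Pu = u , Pu , [] , p , [] , refl
    firstHit []         Pw | no ¬Pu = ⊥-elim (¬Pu Pw)
    firstHit (step e p) Pw | no ¬Pu with firstHit p Pw
    ... | y , Py , q , r , q-avoids , refl = y , Py , step e q , r , ¬Pu ∷ q-avoids , refl

  toPath : (p : Route u w) → Σ (Route u w) λ π → IsPath π × vertices π ⊆ vertices p
  toPath []             = [] , [] ∷ [] , id
  toPath {u} (step e p) with toPath p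
  ... | π , π-path , π⊆p with u ∈? vertices π
  ...   | no u∉π = step e π , All.¬Any⇒All¬ (vertices π) u∉π ∷ π-path ,
                   λ { (here refl) → here refl ; (there x∈) → there (π⊆p x∈) }
  ...   | yes u∈π with splitAt π u∈π
  ...     | q , r , refl = r , IsPath-++ᵣ⁻ʳ q r π-path , there ∘ π⊆p ∘ vertices-++ᵣ⁺ʳ q r

  departures-++ᵣ-step : (p : Route u v) (e : Adj H v x) (q : Route x w) →
                        1 ≤ length (departures (p ++ᵣ step e q))
  departures-++ᵣ-step []         _ _ = s≤s z≤n
  departures-++ᵣ-step (step _ _) _ _ = s≤s z≤n

  closed⇒HasCycle : (c : Route s s) → Unique (departures c) → 3 ≤ length (departures c) → HasCycle H
  closed⇒HasCycle {s} (step e c) c-uniq (s≤s 2≤len) =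
    s , departures c , 2≤len , c-uniq ,
    subst (λ xs → Linked (Adj H) (s ∷ xs)) (vertices≡departures∷ʳ c) (vertices-linked (step e c))

  -- The cycle runs from s to v, along σ until its first return y to w, and
  -- back from y to s inside w.
  detour⇒cycle : (e : Adj H s v) (σ : Route v t) → IsPath (step e σ) →
                 (w : Route s t) → v ∉ vertices w → HasCycle H
  detour⇒cycle {s = s} e σ σ-path@(s∉σ ∷ _) w v∉w with firstHit (_∈? vertices w) σ (end∈ w)
  ... | y , y∈w , [] , _ = ⊥-elim (v∉w y∈w)
  ... | y , y∈w , μ@(step _ μ′) , ρ , μ-avoids , refl with splitAt w y∈w
  ...   | q , _ , refl with toPath (reverse q)
  ...     | [] , _ , _ = ⊥-elim (All.lookup s∉σ (vertices-++ᵣ⁺ʳ μ ρ (start∈ ρ)) refl)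
  ...     | π@(step e′ π′) , π-path , π⊆ =
    closed⇒HasCycle (step e (μ ++ᵣ π))
      (subst (Unique ∘ (s ∷_)) (≡-sym (departures-++ᵣ μ π))
        (Unique.++⁺ (IsPath-++ᵣ⁻ˡ (step e μ) ρ σ-path) (IsPath⇒Unique-departures π π-path) disjoint))
      (s≤s (s≤s (departures-++ᵣ-step μ′ e′ π′)))
    where
      π⊆w : vertices π ⊆ vertices (q ++ᵣ _)
      π⊆w = vertices-++ᵣ⁺ˡ q _ ∘ vertices-reverse q ∘ π⊆
      disjoint : Disjoint (s ∷ departures μ) (departures π)
      disjoint (here refl , x∈π) =
        Unique-++⇒Disjoint (departures π) (subst Unique (vertices≡departures∷ʳ π) π-path) (x∈π , here refl)
      disjoint (there x∈μ , x∈π) = All.lookup μ-avoids x∈μ (π⊆w (departures⊆vertices π x∈π))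

  path⊆route : ¬ HasCycle H → (σ : Route s t) → IsPath σ → (w : Route s t) → vertices σ ⊆ vertices w
  path⊆route _ []         _ w (here refl) = start∈ w
  path⊆route _ (step _ _) _ w (here refl) = start∈ w
  path⊆route acyclic (step {v = v} e σ) σ-path@(_ ∷ σ′-path) w (there z∈σ) with v ∈? vertices w
  ... | no v∉w = ⊥-elim (acyclic (detour⇒cycle e σ σ-path w v∉w))
  ... | yes v∈w with splitAt w v∈w
  ...   | q , r , refl = vertices-++ᵣ⁺ʳ q r (path⊆route acyclic σ σ′-path r z∈σ)

  -- z is the first vertex of the path inside α that lies on the path inside β;
  -- joining the two paths at z gives an s–t path, which γ must contain.
  triangle-meets : ¬ HasCycle H → (α : Route s v) (β : Route v t) (γ : Route s t) →
                   ∃[ z ] z ∈ vertices α × z ∈ vertices β × z ∈ vertices γ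
  triangle-meets acyclic α β γ with toPath α | toPath β
  ... | π₁ , π₁-path , π₁⊆α | π₂ , π₂-path , π₂⊆β
    with firstHit (_∈? vertices π₂) π₁ (start∈ π₂)
  ... | z , z∈π₂ , μ , ρ₁ , μ-avoids , refl with splitAt π₂ z∈π₂
  ... | ρ₀ , ρ , refl =
    z , π₁⊆α (vertices-++ᵣ⁺ˡ μ ρ₁ (end∈ μ)) , π₂⊆β z∈π₂ ,
    path⊆route acyclic (μ ++ᵣ ρ) σ-path γ (vertices-++ᵣ⁺ʳ μ ρ (start∈ ρ))
    where
      σ-path : IsPath (μ ++ᵣ ρ)
      σ-path = IsPath-++ᵣ⁺ μ ρ (IsPath-++ᵣ⁻ˡ μ ρ₁ π₁-path) (IsPath-++ᵣ⁻ʳ ρ₀ ρ π₂-path)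
                 (λ (x∈μ , x∈ρ) → All.lookup μ-avoids x∈μ (vertices-++ᵣ⁺ʳ ρ₀ ρ x∈ρ))

module _ {n : ℕ} {G : Graph n} where

  _++ʷ_ : ∀ {x y z i j} → Walk G x y i → Walk G y z j → Walk G x z (i + j)
  []       ++ʷ W = W
  step e V ++ʷ W = step e (V ++ʷ W)

  reverseʷ : ∀ {x y ℓ} → Walk G x y ℓ → Walk G y x ℓ
  reverseʷ []                    = []
  reverseʷ {ℓ = suc ℓ} (step e W) = subst (Walk G _ _) (+-comm ℓ 1) (reverseʷ W ++ʷ step (sym G e) [])

  AllOn-map : ∀ {P Q : Fin n → Set} → (∀ {u} → P u → Q u) →
              ∀ {x y ℓ} {W : Walk G x y ℓ} → AllOn G P W → AllOn G Q W
  AllOn-map f ([] Px)     = [] (f Px)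
  AllOn-map f (step Px P) = step (f Px) (AllOn-map f P)

Between : ∀ {n} (G : Graph n) → Fin n → Fin n → ℕ → Fin n → Set
Between G x y ℓ u = ∃₂ λ i j → Walk G x u i × Walk G u y j × i + j ≤ ℓ

vertices-between : ∀ {n} {G : Graph n} {x y ℓ} (W : Walk G x y ℓ) → AllOn G (Between G x y ℓ) W
vertices-between []                     = [] (0 , 0 , [] , [] , z≤n)
vertices-between {ℓ = suc ℓ} (step e W) =
  step (0 , suc ℓ , [] , step e W , ≤-refl)
       (AllOn-map (λ (i , j , x⇝u , u⇝y , i+j≤ℓ) → suc i , j , step e x⇝u , u⇝y , s≤s i+j≤ℓ)
                  (vertices-between W))

module _ {n : ℕ} {G : Graph n} (D : TreeDecomposition G) where
  open Routes (T D)

  BagMeets : (Fin n → Set) → Fin (m D) → Set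
  BagMeets Q t = ∃[ u ] Q u × Bag D t u

  fromWalk : ∀ {Q : Fin (m D) → Set} {s t ℓ} (W : Walk (T D) s t ℓ) → AllOn (T D) Q W →
             Σ (Route s t) λ p → All Q (vertices p)
  fromWalk []         ([] Qs)     = [] , Qs ∷ []
  fromWalk (step e W) (step Qs QW) with fromWalk W QW
  ... | p , Qp = step e p , Qs ∷ Qp

  liftWalk : ∀ {Q : Fin n → Set} {x y ℓ} (W : Walk G x y ℓ) → AllOn G Q W →
             ∀ {s t} → Bag D s x → Bag D t y → Σ (Route s t) λ p → All (BagMeets Q) (vertices p)
  liftWalk {x = x} [] ([] Qx) s∋x t∋x with subtree D x _ _ s∋x t∋x
  ... | _ , V , V∋x with fromWalk V V∋x
  ...   | p , p∋x = p , All.map (λ t∋x → x , Qx , t∋x) p∋x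
  liftWalk {x = x} (step e W) (step Qx QW) s∋x t∋y with edges D _ _ e
  ... | r , r∋x , r∋x′ with subtree D x _ _ s∋x r∋x | liftWalk W QW r∋x′ t∋y
  ...   | _ , V , V∋x | q , q-meets with fromWalk V V∋x
  ...     | p , p∋x = p ++ᵣ q , All-vertices-++ᵣ p q (All.map (λ t∋x → x , Qx , t∋x) p∋x) q-meets

  triangle-bag : ∀ {P Q R : Fin n → Set} {x y z ℓ₁ ℓ₂ ℓ₃}
                 (U : Walk G x y ℓ₁) → AllOn G P U → (V : Walk G y z ℓ₂) → AllOn G Q V →
                 (W : Walk G x z ℓ₃) → AllOn G R W →
                 ∃[ t ] BagMeets P t × BagMeets Q t × BagMeets R t
  triangle-bag {x = x} {y} {z} U PU V QV W RW
    with covers D x | covers D y | covers D z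
  ... | r , r∋x | s , s∋y | t , t∋z
    with liftWalk U PU r∋x s∋y | liftWalk V QV s∋y t∋z | liftWalk W RW r∋x t∋z
  ... | α , α-P | β , β-Q | γ , γ-R with triangle-meets (proj₂ (isTree D)) α β γ
  ... | c , c∈α , c∈β , c∈γ = c , All.lookup α-P c∈α , All.lookup β-Q c∈β , All.lookup γ-R c∈γ

+-cancel-outer-≤ : ∀ i j j′ i′ r → (i + j) + (j′ + i′) ≤ i + (r + i′) → j + j′ ≤ r
+-cancel-outer-≤ i j j′ i′ r le =
  +-cancelʳ-≤ i′ (j + j′) r (+-cancelˡ-≤ i _ _ (subst (_≤ i + (r + i′)) (regroup i j j′ i′) le))
  where
    regroup : ∀ i j j′ i′ → (i + j) + (j′ + i′) ≡ i + ((j + j′) + i′)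
    regroup = solve-∀

2*[j+r]≤3*k : ∀ {j j′ r k} → j + j′ ≤ k → j ≤ j′ → r ≤ k → 2 * (j + r) ≤ 3 * k
2*[j+r]≤3*k {j} {j′} {r} {k} j+j′≤k j≤j′ r≤k = begin
  2 * (j + r)     ≡⟨ distrib j r ⟩
  (j + j) + 2 * r ≤⟨ +-mono-≤ (≤-trans (+-monoʳ-≤ j j≤j′) j+j′≤k) (*-monoʳ-≤ 2 r≤k) ⟩
  k + 2 * k       ≡⟨ collect k ⟩
  3 * k           ∎
  where
    open ≤-Reasoning
    distrib : ∀ j r → 2 * (j + r) ≡ (j + j) + 2 * r
    distrib = solve-∀
    collect : ∀ k → k + 2 * k ≡ 3 * k
    collect = solve-∀

module _ {n : ℕ} {G : Graph n} {k : ℕ} {A : Fin n → Set} where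

  near-A : ∀ {v x y a′ j j′} → A a′ → Walk G x v j → Walk G v y j′ → j + j′ ≤ k →
           DistLe G x a′ k → DistLe G y a′ k → InBall3k/2 G A k v
  near-A {j = j} {j′} a′∈A x⇝v v⇝y j+j′≤k (r₁ , r₁≤k , x⇝a′) (r₂ , r₂≤k , y⇝a′) with j ≤? j′
  ... | yes j≤j′ = _ , a′∈A , j + r₁ , 2*[j+r]≤3*k j+j′≤k j≤j′ r₁≤k , reverseʷ x⇝v ++ʷ x⇝a′
  ... | no  j≰j′ = _ , a′∈A , j′ + r₂ ,
                   2*[j+r]≤3*k (subst (_≤ k) (+-comm j j′) j+j′≤k) (≰⇒≥ j≰j′) r₂≤k , v⇝y ++ʷ y⇝a′

  geodesic-vertex-near-A : ∀ (D : TreeDecomposition G) → LengthLe D k → InducedConnected G A →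
    ∀ {a b v ℓ₁ ℓ₂} → A a → A b → Walk G a v ℓ₁ → Walk G v b ℓ₂ →
    (∀ ℓ → Walk G a b ℓ → ℓ₁ + ℓ₂ ≤ ℓ) → InBall3k/2 G A k v
  geodesic-vertex-near-A D D-length A-connected {a} {b} a∈A b∈A a⇝v v⇝b shortest
    with A-connected a b a∈A b∈A
  ... | _ , a⇝b , a⇝b-in-A
    with triangle-bag D a⇝v (vertices-between a⇝v) v⇝b (vertices-between v⇝b) a⇝b a⇝b-in-A
  ... | t , (x , (i , j , a⇝x , x⇝v , i+j≤ℓ₁) , t∋x)
          , (y , (j′ , i′ , v⇝y , y⇝b , j′+i′≤ℓ₂) , t∋y) , (a′ , a′∈A , t∋a′)
    with D-length t x y t∋x t∋y
  ... | r , r≤k , x⇝y =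
    near-A a′∈A x⇝v v⇝y (≤-trans j+j′≤r r≤k) (D-length t x a′ t∋x t∋a′) (D-length t y a′ t∋y t∋a′)
    where
      j+j′≤r : j + j′ ≤ r
      j+j′≤r = +-cancel-outer-≤ i j j′ i′ r
                 (≤-trans (+-mono-≤ i+j≤ℓ₁ j′+i′≤ℓ₂) (shortest _ (a⇝x ++ʷ (x⇝y ++ʷ y⇝b))))

lemma1 : ∀ {n : ℕ} (G : Graph n) (k : ℕ) → 1 ≤ k → TreelengthLe G k →
    (A : Fin n → Set) → InducedConnected G A →
    ∀ {a b ℓ} → A a → A b → (P : Walk G a b ℓ) → IsShortest G P →
    AllOn G (λ v → InBall3k/2 G A k v) P
lemma1 G k _ (D , D-length) A A-connected a∈A b∈A P P-shortest =
  AllOn-map (λ (_ , _ , a⇝v , v⇝b , ℓ₁+ℓ₂≤ℓ) →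
               geodesic-vertex-near-A D D-length A-connected a∈A b∈A a⇝v v⇝b
                 (λ ℓ′ W → ≤-trans ℓ₁+ℓ₂≤ℓ (P-shortest ℓ′ W)))
            (vertices-between P)
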